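{- The classes $\mathsf{FH}$, $\mathsf{FI}$ and $\mathsf{FIFD}$ have the local fixed-point property.
   Context: Language $\mathcal{L}$: countably many individual variables, Boolean constants $\top,\bot$, connectives $\neg,\to$, quantifier $\forall$, modal operator $\Box$, countably many predicate symbols of each arity. Formulas: $\top$, $\bot$, $P(u_1,\ldots,u_n)$, closed under $\neg$, $\to$, $\forall u$, $\Box$. $\mathcal{L}'$ is $\mathcal{L}$ together with one fixed propositional variable $p$. For an $\mathcal{L}'$-formula $A(p)$ and $\mathcal{L}$-formula $B$, $A(B)$ is the result of replacing every occurrence of $p$ by $B$. $A(p)$ is modalized in $p$ if every occurrence of $p$ lies within the scope of a $\Box$. Kripke frame: $\mathcal{F}=\langle W,\prec,\{D_w\}_{w\in W}\rangle$, $W\neq\emptyset$, $\prec$ binary relation on $W$, each $D_w$ nonempty with $D_w\subseteq D_{w'}$ whenever $w\prec w'$. Interpretations assign to each world and $n$-ary predicate an $n$-ary relation on $D_w$; truth is standard ($\forall$ ranges over $D_w$, $\Box A$ true at $w$ iff $A$ true at all $\prec$-successors). $\mathcal{F}\models A$ means the universal closure of $A$ is true at every world under every interpretation. A frame is conversely well-founded if there is no infinite sequence $w_0\prec w_1\prec\cdots$; then $h(w)=\sup\{h(v)+1: w\prec v\}$ ($\sup\emptyset=0$) and the height of the frame is $\sup_{w}h(w)$. $\mathsf{FH}$: transitive, conversely well-founded frames of finite height. $\mathsf{FI}$: frames with $W$ finite and $\prec$ transitive and irreflexive. $\mathsf{FIFD}$: frames in $\mathsf{FI}$ all of whose domains $D_w$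 are finite. A class $\mathsf{C}$ has the local fixed-point property if for every $\mathcal{L}'$-formula $A(p)$ modalized in $p$ and every frame $\mathcal{F}\in\mathsf{C}$ there exists an $\mathcal{L}$-formula $B$ containing only predicate symbols occurring in $A$ such that $\mathcal{F}\models B\leftrightarrow A(B)$. -}

module Defs where

open import Data.Nat using (ℕ; zero; suc)
open import Data.Fin using (Fin)
open import Data.Nat.Properties using (_≟_)
open import Relation.Nullary.Decidable using (Dec)
open import Data.Empty using (⊥; ⊥-elim)
open import Data.Unit using (⊤; tt)
open import Data.Product using (Σ; ∃; _×_; _,_)
open import Data.List using (List)
open import Data.Sum using (_⊎_)
open import Data.List.Membership.Propositional using (_∈_)
open import Relation.Nullary using (¬_; yes; no)
open import Relation.Binary.PropositionalEquality using (_≡_)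

-- L  = Form ⊥   (no propositional variable)
--   L' = Form ⊤   (the single propositional variable p = pv tt)
-- Individual variables are natural numbers.  A predicate symbol is a
-- pair (arity n, index i); an atomic formula applies it to n variables.

data Form (A : Set) : Set where
  ⊤'   : Form A
  ⊥'   : Form A
  pv   : A → Form A
  pred : (n i : ℕ) → (Fin n → ℕ) → Form A
  ¬'_  : Form A → Form A
  _⇒_  : Form A → Form A → Form A
  ∀'   : ℕ → Form A → Form A
  □_   : Form A → Form A

infixr 5 _⇒_
infix 6 ¬'_ □_

L : Set
L = Form ⊥

L' : Set
L' = Form ⊤

p : L'
p = pv tt

-- A(B): literal replacement of every occurrence of p by B (no renaming).
_[_] : L' → L → L
⊤' [ B ] = ⊤'
⊥' [ B ] = ⊥'
pv _ [ B ] = B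
pred n i xs [ B ] = pred n i xs
(¬' A) [ B ] = ¬' (A [ B ])
(A ⇒ C) [ B ] = (A [ B ]) ⇒ (C [ B ])
∀' u A [ B ] = ∀' u (A [ B ])
(□ A) [ B ] = □ (A [ B ])

Modalized : L' → Set
Modalized ⊤' = ⊤
Modalized ⊥' = ⊤
Modalized (pv _) = ⊥
Modalized (pred _ _ _) = ⊤
Modalized (¬' A) = Modalized A
Modalized (A ⇒ C) = Modalized A × Modalized C
Modalized (∀' _ A) = Modalized A
Modalized (□ _) = ⊤

Occurs : {A : Set} → ℕ → ℕ → Form A → Set
Occurs n i ⊤' = ⊥
Occurs n i ⊥' = ⊥
Occurs n i (pv _) = ⊥
Occurs n i (pred m j _) = (n ≡ m) × (i ≡ j)
Occurs n i (¬' A) = Occurs n i A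
Occurs n i (A ⇒ C) = Occurs n i A ⊎ Occurs n i C
Occurs n i (∀' _ A) = Occurs n i A
Occurs n i (□ A) = Occurs n i A

-- Kripke frames with increasing domains.  The domains are subsets
-- Dom w of a common carrier U, so that D_w ⊆ D_w' is literal inclusion.

record Frame : Set₁ where
  field
    W        : Set
    _≺_      : W → W → Set
    U        : Set
    Dom      : W → U → Set
    W-ne     : W
    Dom-ne   : ∀ w → Σ U (Dom w)
    Dom-mono : ∀ {w w' d} → w ≺ w' → Dom w d → Dom w' d

module _ (F : Frame) where
  open Frame F

  -- an interpretation: for each world and predicate symbol (arity n,
  -- index i), an n-ary relation (only its values on D_w matter).
  Interp : Set₁
  Interp = W → (n i : ℕ) → (Fin n → U) → Set

  Assignment : Set
  Assignment = ℕ → U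

  _[_↦_]ₐ : Assignment → ℕ → U → Assignment
  (g [ u ↦ d ]ₐ) v with v ≟ u
  ... | yes _ = d
  ... | no  _ = g v

  Sat : Interp → W → Assignment → L → Set
  Sat I w g ⊤' = ⊤
  Sat I w g ⊥' = ⊥
  Sat I w g (pv ())
  Sat I w g (pred n i xs) = I w n i (λ k → g (xs k))
  Sat I w g (¬' A) = ¬ Sat I w g A
  Sat I w g (A ⇒ B) = Sat I w g A → Sat I w g B
  Sat I w g (∀' u A) = (d : U) → Dom w d → Sat I w (g [ u ↦ d ]ₐ) A
  Sat I w g (□ A) = (v : W) → w ≺ v → Sat I v g A

  -- F ⊨ A: the universal closure of A is true at every world under every
  -- interpretation, i.e. A holds at every world w under every assignment
  -- of elements of D_w to the variables.
  Valid : L → Set₁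
  Valid A = (I : Interp) (w : W) (g : Assignment) →
            (∀ v → Dom w (g v)) → Sat I w g A

_⊨_ : Frame → L → Set₁
F ⊨ A = Valid F A

module _ (F : Frame) where
  open Frame F

  Transitive : Set
  Transitive = ∀ {u v w} → u ≺ v → v ≺ w → u ≺ w

  Irreflexive : Set
  Irreflexive = ∀ {w} → ¬ (w ≺ w)

  ConverselyWellFounded : Set
  ConverselyWellFounded = ¬ (Σ (ℕ → W) λ f → ∀ k → f k ≺ f (suc k))

  -- HeightLE n w  ⇔  h(w) ≤ n  (h(w) = sup{h(v)+1 : w ≺ v}, sup ∅ = 0)
  HeightLE : ℕ → W → Set
  HeightLE zero w = ∀ v → ¬ (w ≺ v)
  HeightLE (suc n) w = ∀ v → w ≺ v → HeightLE n v

  FiniteHeight : Set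
  FiniteHeight = Σ ℕ λ n → ∀ w → HeightLE n w

  FiniteWorlds : Set
  FiniteWorlds = Σ (List W) λ ws → ∀ w → w ∈ ws

  FiniteDomains : Set
  FiniteDomains = ∀ w → Σ (List U) λ ds → ∀ d → Dom w d → d ∈ ds

FH : Frame → Set
FH F = Transitive F × ConverselyWellFounded F × FiniteHeight F

FI : Frame → Set
FI F = FiniteWorlds F × Transitive F × Irreflexive F

FIFD : Frame → Set
FIFD F = FI F × FiniteDomains F

LocalFixedPointProperty : (Frame → Set) → Set₁
LocalFixedPointProperty C =
  (A : L') → Modalized A → (F : Frame) → C F →
  Σ L λ B →
    (∀ n i → Occurs n i B → Occurs n i A) ×
    (F ⊨ (B ⇒ (A [ B ]))) × (F ⊨ ((A [ B ]) ⇒ B))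

module Submission where

-- For a formula A(p) modalized in p, write Aᵏ for the k-th iterate of A
-- applied to ⊤ (A⁰ = ⊤, Aᵏ⁺¹ = A(Aᵏ)).  On a transitive frame, whether
-- A(X) and A(Y) agree at a world w only depends on X and Y agreeing at the
-- strict successors of w, because every p in A sits under a □.  By
-- induction on m it follows that at a world of height ≤ m all iterates Aʲ
-- with j > m agree.  Hence on a transitive frame of height ≤ n the formula
-- B = Aⁿ⁺¹ satisfies B ↔ A(B) everywhere; it only mentions predicate
-- symbols of A.  This settles FH directly.  For FI we show that in a
-- finite transitive irreflexive frame with worlds listed in ws every world
-- has height ≤ length ws: a successor v of w cannot be among v's own
-- successors, so removing it from the list bounds the height of v by
-- induction.  FIFD ⊆ FI finishes the proof.

open import Defs
open import Data.Product using (Σ; _×_; _,_)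
open import Data.Sum using (_⊎_; inj₁; inj₂)
open import Data.Empty using (⊥-elim)
open import Data.Nat using (ℕ; zero; suc; _<_; s≤s)
open import Data.Nat.Properties using (n<1+n; m<n⇒m<1+n; suc-injective)
open import Data.List using (List; []; _∷_; length)
open import Data.List.Properties using (length-removeAt′)
open import Data.List.Relation.Unary.Any using (here; there; _─_; index)
open import Data.List.Membership.Propositional using (_∈_)
open import Function.Bundles using (_⇔_; mk⇔; Equivalence)
open import Function.Related.TypeIsomorphisms using (→-cong-⇔; ¬-cong-⇔)
open import Relation.Binary.PropositionalEquality using (_≡_; _≢_; refl; trans; sym)

occurs-[] : ∀ {n i} (A : L') (X : L) → Occurs n i (A [ X ]) → Occurs n i A ⊎ Occurs n i X
occurs-[] ⊤'           X ()
occurs-[] ⊥'           X ()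
occurs-[] (pv _)       X o = inj₂ o
occurs-[] (pred _ _ _) X o = inj₁ o
occurs-[] (¬' A)       X o = occurs-[] A X o
occurs-[] (A ⇒ C)      X (inj₁ o) with occurs-[] A X o
... | inj₁ q = inj₁ (inj₁ q)
... | inj₂ q = inj₂ q
occurs-[] (A ⇒ C)      X (inj₂ o) with occurs-[] C X o
... | inj₁ q = inj₁ (inj₂ q)
... | inj₂ q = inj₂ q
occurs-[] (∀' _ A)     X o = occurs-[] A X o
occurs-[] (□ A)        X o = occurs-[] A X o

iterate : L' → ℕ → L
iterate A zero    = ⊤'
iterate A (suc k) = A [ iterate A k ]

occurs-iterate : ∀ {n i} (A : L') (k : ℕ) → Occurs n i (iterate A k) → Occurs n i A
occurs-iterate A zero    ()
occurs-iterate A (suc k) o with occurs-[] A (iterate A k) o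
... | inj₁ q = q
... | inj₂ q = occurs-iterate A k q

module Agreement (F : Frame) (≺-trans : Transitive F) (I : Interp F) where
  open Frame F

  infix 4 _⊢_≈_ _⊢□_≈_

  _⊢_≈_ : W → L → L → Set
  w ⊢ X ≈ Y = ∀ g → Sat F I w g X ⇔ Sat F I w g Y

  _⊢□_≈_ : W → L → L → Set
  w ⊢□ X ≈ Y = ∀ v → w ≺ v → v ⊢ X ≈ Y

  □-persists : ∀ {w v X Y} → w ⊢□ X ≈ Y → w ≺ v → v ⊢□ X ≈ Y
  □-persists above wv u vu = above u (≺-trans wv vu)

  -- Agreement at w itself is needed
  -- only when p has an occurrence outside every □, i.e. when A is not
  -- modalized; occurrences under □ are handled by agreement above w.
  substitution-congruence : ∀ (A : L') {w X Y} → Modalized A ⊎ (w ⊢ X ≈ Y) →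
                            w ⊢□ X ≈ Y → w ⊢ A [ X ] ≈ A [ Y ]
  substitution-congruence ⊤'           _          _     g = mk⇔ (λ z → z) (λ z → z)
  substitution-congruence ⊥'           _          _     g = mk⇔ (λ z → z) (λ z → z)
  substitution-congruence (pv _)       (inj₁ ())  _     g
  substitution-congruence (pv _)       (inj₂ X≈Y) _     g = X≈Y g
  substitution-congruence (pred _ _ _) _          _     g = mk⇔ (λ z → z) (λ z → z)
  substitution-congruence (¬' A)       here≈      above g =
    ¬-cong-⇔ (substitution-congruence A here≈ above g)
  substitution-congruence (A ⇒ C)      here≈      above g =
    →-cong-⇔ (substitution-congruence A (left here≈) above g)
             (substitution-congruence C (right here≈) above g)
    where
    left : ∀ {Q} → Modalized (A ⇒ C) ⊎ Q → Modalized A ⊎ Q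
    left (inj₁ (ma , _)) = inj₁ ma
    left (inj₂ q)        = inj₂ q
    right : ∀ {Q} → Modalized (A ⇒ C) ⊎ Q → Modalized C ⊎ Q
    right (inj₁ (_ , mc)) = inj₁ mc
    right (inj₂ q)        = inj₂ q
  substitution-congruence (∀' _ A) {w} {X} {Y} here≈ above g =
    mk⇔ (λ f d d∈ → Equivalence.to   (A≈ _) (f d d∈))
        (λ f d d∈ → Equivalence.from (A≈ _) (f d d∈))
    where
    A≈ : w ⊢ A [ X ] ≈ A [ Y ]
    A≈ = substitution-congruence A here≈ above
  substitution-congruence (□ A) {w} {X} {Y} _ above g =
    mk⇔ (λ f v wv → Equivalence.to   (A≈ wv g) (f v wv))
        (λ f v wv → Equivalence.from (A≈ wv g) (f v wv))
    where
    A≈ : ∀ {v} → w ≺ v → v ⊢ A [ X ] ≈ A [ Y ]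
    A≈ {v} wv = substitution-congruence A (inj₂ (above v wv)) (□-persists {X = X} {Y = Y} above wv)

  modalized-congruence : ∀ (A : L') {w X Y} → Modalized A →
                         w ⊢□ X ≈ Y → w ⊢ A [ X ] ≈ A [ Y ]
  modalized-congruence A mod = substitution-congruence A (inj₁ mod)

  iterates-stabilise : ∀ (A : L') → Modalized A → ∀ m {w} → HeightLE F m w →
                       ∀ {j k} → m < j → m < k → w ⊢ iterate A j ≈ iterate A k
  iterates-stabilise A mod zero    maximal {suc j} {suc k} _ _ =
    modalized-congruence A mod (λ v wv → ⊥-elim (maximal v wv))
  iterates-stabilise A mod (suc m) h≤ {suc j} {suc k} (s≤s m<j) (s≤s m<k) =
    modalized-congruence A mod (λ v wv → iterates-stabilise A mod m (h≤ v wv) m<j m<k)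

HasLocalFixedPoint : L' → Frame → Set₁
HasLocalFixedPoint A F =
  Σ L λ B → (∀ n i → Occurs n i B → Occurs n i A) ×
            (F ⊨ (B ⇒ (A [ B ]))) × (F ⊨ ((A [ B ]) ⇒ B))

bounded-height-fixed-point : ∀ (A : L') → Modalized A → (F : Frame) → Transitive F →
                             (n : ℕ) → (∀ w → HeightLE F n w) → HasLocalFixedPoint A F
bounded-height-fixed-point A mod F ≺-trans n height≤n =
  iterate A (suc n) , (λ _ _ → occurs-iterate A (suc n)) ,
  (λ I w g _ → Equivalence.from (fixed I w g)) ,
  (λ I w g _ → Equivalence.to   (fixed I w g))
  where
  fixed : ∀ I w → let open Agreement F ≺-trans I in
          w ⊢ A [ iterate A (suc n) ] ≈ iterate A (suc n)
  fixed I w = iterates-stabilise A mod n (height≤n w) (m<n⇒m<1+n (n<1+n n)) (n<1+n n)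
    where open Agreement F ≺-trans I

∈-─ : ∀ {a} {X : Set a} {u v : X} (xs : List X) (u∈ : u ∈ xs) → v ∈ xs → v ≢ u → v ∈ (xs ─ u∈)
∈-─ (x ∷ xs) (here u≡x) (here v≡x) v≢u = ⊥-elim (v≢u (trans v≡x (sym u≡x)))
∈-─ (x ∷ xs) (here _)   (there v∈) _   = v∈
∈-─ (x ∷ xs) (there _)  (here v≡x) _   = here v≡x
∈-─ (x ∷ xs) (there u∈) (there v∈) v≢u = there (∈-─ xs u∈ v∈ v≢u)

successors-bound-height : (F : Frame) → Transitive F → Irreflexive F →
  ∀ n (xs : List (Frame.W F)) → length xs ≡ n →
  ∀ w → (∀ v → Frame._≺_ F w v → v ∈ xs) → HeightLE F n w
successors-bound-height F ≺-trans ≺-irrefl zero [] _ w succ∈ v wv with succ∈ v wv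
... | ()
successors-bound-height F ≺-trans ≺-irrefl (suc n) xs |xs|≡ w succ∈ v wv =
  successors-bound-height F ≺-trans ≺-irrefl n (xs ─ v∈) |xs─v|≡n v
    (λ u vu → ∈-─ xs v∈ (succ∈ u (≺-trans wv vu)) (λ { refl → ≺-irrefl vu }))
  where
  v∈ = succ∈ v wv
  |xs─v|≡n : length (xs ─ v∈) ≡ n
  |xs─v|≡n = suc-injective (trans (sym (length-removeAt′ xs (index v∈))) |xs|≡)

finite-irreflexive-height : (F : Frame) → FI F →
  Σ ℕ λ n → ∀ w → HeightLE F n w
finite-irreflexive-height F ((ws , all∈) , ≺-trans , ≺-irrefl) =
  length ws , λ w → successors-bound-height F ≺-trans ≺-irrefl _ ws refl w (λ v _ → all∈ v)

corollary4p9 : LocalFixedPointProperty FH × LocalFixedPointProperty FI × LocalFixedPointProperty FIFD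
corollary4p9 = fh , fi , fifd
  where
  fh : LocalFixedPointProperty FH
  fh A mod F (≺-trans , _ , n , height≤n) = bounded-height-fixed-point A mod F ≺-trans n height≤n

  fi : LocalFixedPointProperty FI
  fi A mod F fi-F@(_ , ≺-trans , _) with finite-irreflexive-height F fi-F
  ... | n , height≤n = bounded-height-fixed-point A mod F ≺-trans n height≤n

  fifd : LocalFixedPointProperty FIFD
  fifd A mod F (fi-F , _) = fi A mod F fi-F
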